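{- Let $i\in\mathbb{Z}$ and let $a,a'\in\mathbb{A}_i$ be distinct. If $Z\in\mathsf{Pred}$ and $a'\#Z$ then $Z[a\mapsto\mathsf{atm}(a')]=(a'\ a)\cdot Z$. If $k\in\mathbb{Z}$, $z\in\mathsf{Set}_k$ and $a'\#z$ then $z[a\mapsto\mathsf{atm}(a')]=(a'\ a)\cdot z$.
   Context: Atoms: for each $i\in\mathbb{Z}$ fix a countably infinite set $\mathbb{A}_i$ of atoms, pairwise disjoint, $\mathbb{A}=\bigcup_i\mathbb{A}_i$, $\mathrm{level}(a)=i$ iff $a\in\mathbb{A}_i$. Permutations are finitely-supported level-preserving bijections of $\mathbb{A}$; $(a\ b)$ is the swapping of $a$ and $b$, acting on all objects below by renaming atoms; $\mathrm{supp}(x)$ is the least finite set of atoms such that every permutation fixing it pointwise fixes $x$, and $a\#x$ means $a\notin\mathrm{supp}(x)$. $[a]X$ is nominal atoms-abstraction (binding $a$ in $X$): $[a]X=[b]((b\ a)\cdot X)$ when $b\#X$. Internal syntax: $\mathsf{Pred}$ and $\mathsf{Set}_i$ ($i\in\mathbb{Z}$) are defined inductively: $\mathsf{atm}(a)\in\mathsf{Set}_i$ for $a\in\mathbb{A}_i$; $\mathsf{and}(\mathcal X)\in\mathsf{Pred}$ for finite $\mathcal X\subseteq\mathsf{Pred}$; $\mathsf{neg}(X)$; $\mathsf{all}([a]X)$ for $a\in\mathbb{A}$; $\mathsf{elt}(x,a)\in\mathsf{Pred}$ for $a\in\mathbb{A}_{i+1}$, $x\in\mathsf{Set}_i$; $\mathsf{st}([a]X)\in\mathsf{Set}_i$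 for $a\in\mathbb{A}_{i-1}$, $X\in\mathsf{Pred}$. Sigma-action: for $a\in\mathbb{A}_i$, $x\in\mathsf{Set}_i$, the well-defined operation $Z[a\mapsto x]$, $z[a\mapsto x]$ is given by (with $b,c$ atoms distinct from $a$): $\mathsf{and}(\mathcal X)[a\mapsto x]=\mathsf{and}(\{X[a\mapsto x]\mid X\in\mathcal X\})$; $\mathsf{neg}(X)[a\mapsto x]=\mathsf{neg}(X[a\mapsto x])$; $\mathsf{all}([b]X)[a\mapsto x]=\mathsf{all}([b](X[a\mapsto x]))$ if $b\#x$; $\mathsf{elt}(y,a)[a\mapsto\mathsf{atm}(n)]=\mathsf{elt}(y[a\mapsto\mathsf{atm}(n)],n)$ for any $n\in\mathbb{A}_i$; $\mathsf{elt}(y,a)[a\mapsto\mathsf{st}([a']X')]=X'[a'\mapsto y[a\mapsto\mathsf{st}([a']X')]]$ for fresh $a'\in\mathbb{A}_{i-1}$; $\mathsf{elt}(y,b)[a\mapsto x]=\mathsf{elt}(y[a\mapsto x],b)$; $\mathsf{atm}(a)[a\mapsto x]=x$; $\mathsf{atm}(b)[a\mapsto x]=\mathsf{atm}(b)$; $\mathsf{st}([c]X)[a\mapsto x]=\mathsf{st}([c](X[a\mapsto x]))$ if $c\#x$. -}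

module Defs where

open import Data.Nat using (ℕ)
import Data.Nat.Properties as ℕP
open import Data.Integer using (ℤ) renaming (suc to sucℤ; pred to predℤ)
import Data.Integer.Properties as ℤP
open import Data.List using (List; []; _∷_)
open import Data.List.Relation.Unary.All using (All)
open import Data.List.Relation.Unary.Any using (Any)
open import Data.List.Relation.Binary.Pointwise using (Pointwise)
open import Data.Product using (_×_; Σ; ∃; _,_)
open import Data.Sum using (_⊎_)
open import Relation.Binary.PropositionalEquality using (_≡_; _≢_)
open import Relation.Nullary using (¬_; yes; no)

-- Atoms.  𝔸_i is represented by ℕ; the atom  mkAtom i n  is the n-th
-- atom of level i.  level (mkAtom i n) = i.

record Atom : Set where
  constructor mkAtom
  field
    level : ℤ
    idx   : ℕ

-- Raw internal syntax (representatives; equality of Pred / Set_i is the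
-- alpha-equivalence _≈P_ / _≈S_ defined below, which also identifies
-- lists representing the same finite set).
--
--  atm {i} n      : Set_i   is  atm(a)      with a = mkAtom i n
--  and xs         : Pred    is  and(𝒳)      with 𝒳 the finite set of xs
--  neg X          : Pred
--  all a X        : Pred    is  all([a]X)
--  elt {i} y n    : Pred    is  elt(y, a)   with y ∈ Set_i, a = mkAtom (i+1) n
--  st {i} n X     : Set_i   is  st([a]X)    with a = mkAtom (i-1) n

data Pred : Set
data SetT : ℤ → Set

data Pred where
  and : List Pred → Pred
  neg : Pred → Pred
  all : Atom → Pred → Pred
  elt : ∀ {i} → SetT i → ℕ → Pred

data SetT where
  atm : ∀ {i} → ℕ → SetT i
  st  : ∀ {i} → ℕ → Pred → SetT i

swapℕ : ℕ → ℕ → ℕ → ℕ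
swapℕ p q m with m ℕP.≟ p
... | yes _ = q
... | no _ with m ℕP.≟ q
...   | yes _ = p
...   | no _ = m

swapIdx : ℤ → ℕ → ℕ → ℤ → ℕ → ℕ
swapIdx i p q k m with k ℤP.≟ i
... | yes _ = swapℕ p q m
... | no _ = m

swapAtom : ℤ → ℕ → ℕ → Atom → Atom
swapAtom i p q (mkAtom k m) = mkAtom k (swapIdx i p q k m)

swapP : ℤ → ℕ → ℕ → Pred → Pred
swapS : ℤ → ℕ → ℕ → ∀ {k} → SetT k → SetT k
swapL : ℤ → ℕ → ℕ → List Pred → List Pred

swapP i p q (and xs) = and (swapL i p q xs)
swapP i p q (neg X) = neg (swapP i p q X)
swapP i p q (all b X) = all (swapAtom i p q b) (swapP i p q X)
swapP i p q (elt {j} y n) = elt (swapS i p q y) (swapIdx i p q (sucℤ j) n)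
swapS i p q {k} (atm m) = atm (swapIdx i p q k m)
swapS i p q {k} (st c X) = st (swapIdx i p q (predℤ k) c) (swapP i p q X)
swapL i p q [] = []
swapL i p q (X ∷ xs) = swapP i p q X ∷ swapL i p q xs

-- Free atoms (the support of the alpha-class of a raw term).

data FreeP (a : Atom) : Pred → Set
data FreeS (a : Atom) : ∀ {k} → SetT k → Set

data FreeP a where
  free-and  : ∀ {xs} → Any (FreeP a) xs → FreeP a (and xs)
  free-neg  : ∀ {X} → FreeP a X → FreeP a (neg X)
  free-all  : ∀ {b X} → a ≢ b → FreeP a X → FreeP a (all b X)
  free-eltl : ∀ {j} {y : SetT j} {n} → FreeS a y → FreeP a (elt y n)
  free-eltr : ∀ {j} {y : SetT j} {n} → a ≡ mkAtom (sucℤ j) n → FreeP a (elt y n)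

data FreeS a where
  free-atm : ∀ {k m} → a ≡ mkAtom k m → FreeS a (atm {k} m)
  free-st  : ∀ {k c X} → a ≢ mkAtom (predℤ k) c → FreeP a X → FreeS a (st {k} c X)

_#P_ : Atom → Pred → Set
a #P Z = ¬ FreeP a Z

_#S_ : Atom → ∀ {k} → SetT k → Set
a #S z = ¬ FreeS a z

-- Equality of Pred / Set_k : alpha-equivalence (abstractions compared
-- via a fresh atom, Gabbay–Pitts style), with and(𝒳) compared as finite
-- sets (each element of one list is equal to some element of the other).

data _≈P_ : Pred → Pred → Set
data _≈S_ : ∀ {k} → SetT k → SetT k → Set

data _≈P_ where
  ≈and : ∀ {xs ys} →
         All (λ X → Any (λ Y → X ≈P Y) ys) xs →
         All (λ Y → Any (λ X → X ≈P Y) xs) ys →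
         and xs ≈P and ys
  ≈neg : ∀ {X Y} → X ≈P Y → neg X ≈P neg Y
  ≈all : ∀ {l p q X Y} (c : ℕ) →
         mkAtom l c #P X → mkAtom l c #P Y →
         swapP l c p X ≈P swapP l c q Y →
         all (mkAtom l p) X ≈P all (mkAtom l q) Y
  ≈elt : ∀ {j} {y y' : SetT j} {n} → y ≈S y' → elt y n ≈P elt y' n

data _≈S_ where
  ≈atm : ∀ {k m} → atm {k} m ≈S atm {k} m
  ≈st  : ∀ {k p q X Y} (c : ℕ) →
         mkAtom (predℤ k) c #P X → mkAtom (predℤ k) c #P Y →
         swapP (predℤ k) c p X ≈P swapP (predℤ k) c q Y →
         st {k} p X ≈S st {k} q Y

-- The sigma-action  Z[a ↦ atm(n)]  with a = mkAtom i a, n = mkAtom i n,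
-- i.e. exactly the defining clauses of the sigma-action for
-- x = atm(n) (the only case used by the statement), given as the least
-- relation closed under those clauses and under equality of
-- Pred / Set_k.  SubP i a n Z W  means  Z[a ↦ atm(n)] = W.

data SubP (i : ℤ) (a n : ℕ) : Pred → Pred → Set
data SubS (i : ℤ) (a n : ℕ) : ∀ {k} → SetT k → SetT k → Set

data SubP i a n where
  sub-and  : ∀ {xs ys} → Pointwise (SubP i a n) xs ys → SubP i a n (and xs) (and ys)
  sub-neg  : ∀ {X X'} → SubP i a n X X' → SubP i a n (neg X) (neg X')
  sub-all  : ∀ {b X X'} → b ≢ mkAtom i a → b #S atm {i} n →
             SubP i a n X X' → SubP i a n (all b X) (all b X')
  sub-elta : ∀ {j} {y y' : SetT j} → sucℤ j ≡ i →
             SubS i a n y y' → SubP i a n (elt y a) (elt y' n)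
  sub-eltb : ∀ {j} {y y' : SetT j} {b} → mkAtom (sucℤ j) b ≢ mkAtom i a →
             SubS i a n y y' → SubP i a n (elt y b) (elt y' b)
  -- well-definedness on equality classes
  sub-≈    : ∀ {Z Z₁ W₁ W} → Z ≈P Z₁ → SubP i a n Z₁ W₁ → W₁ ≈P W → SubP i a n Z W

data SubS i a n where
  sub-atma : ∀ {k} → k ≡ i → SubS i a n (atm {k} a) (atm {k} n)
  sub-atmb : ∀ {k b} → mkAtom k b ≢ mkAtom i a → SubS i a n (atm {k} b) (atm {k} b)
  sub-st   : ∀ {k c X X'} → mkAtom (predℤ k) c ≢ mkAtom i a →
             mkAtom (predℤ k) c #S atm {i} n →
             SubP i a n X X' → SubS i a n (st {k} c X) (st {k} c X')
  sub-≈    : ∀ {k} {z z₁ w₁ w : SetT k} → z ≈S z₁ → SubS i a n z₁ w₁ → w₁ ≈S w → SubS i a n z w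

-- Induction on the size of Z (swapping preserves size, so the hypothesis
-- also covers swapped subterms).  An atom occurrence is either a (sent to a')
-- or an atom other than a, a' (fixed by (a' a)).  In a binder [b]Y the bound
-- atom may be a or a', so we α-rename it to a fresh c, substitute in (c b)·Y
-- by induction, and α-rename back.  Both renamings are instances of the
-- conjugation identity  (d c)·π·(c b)·Y = (d π(b))·π·Y,  valid for every
-- involution π fixing c and d when c, d occur nowhere in Y.

module Submission where

open import Defs
open import Data.Nat using (ℕ; suc; _<_; _≤_; _⊔_; _+_; s≤s)
import Data.Nat.Properties as ℕP
open import Data.Integer using (ℤ) renaming (suc to sucℤ; pred to predℤ)
import Data.Integer.Properties as ℤP
open import Data.List using (List; []; _∷_)
open import Data.List.Relation.Unary.All as All using (All; []; _∷_)
open import Data.List.Relation.Unary.Any using (Any; here; there)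
open import Data.List.Relation.Binary.Pointwise using (Pointwise; []; _∷_)
open import Data.List.Membership.Propositional using (lose)
open import Data.Product using (_×_; _,_)
open import Data.Unit using (⊤; tt)
open import Function using (_∘_)
open import Relation.Binary.Definitions using (DecidableEquality)
open import Relation.Binary.PropositionalEquality
open import Relation.Nullary using (¬_; yes; no; contradiction)

swapℕ-left : ∀ p q → swapℕ p q p ≡ q
swapℕ-left p q with p ℕP.≟ p
... | yes _ = refl
... | no p≢p = contradiction refl p≢p

swapℕ-right : ∀ p q → swapℕ p q q ≡ p
swapℕ-right p q with q ℕP.≟ p
... | yes q≡p = q≡p
... | no _ with q ℕP.≟ q
...   | yes _ = refl
...   | no q≢q = contradiction refl q≢q

swapℕ-fix : ∀ {p q m} → m ≢ p → m ≢ q → swapℕ p q m ≡ m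
swapℕ-fix {p} {q} {m} m≢p m≢q with m ℕP.≟ p
... | yes m≡p = contradiction m≡p m≢p
... | no _ with m ℕP.≟ q
...   | yes m≡q = contradiction m≡q m≢q
...   | no _ = refl

swapℕ-involutive : ∀ p q m → swapℕ p q (swapℕ p q m) ≡ m
swapℕ-involutive p q m with m ℕP.≟ p
... | yes refl = swapℕ-right m q
... | no m≢p with m ℕP.≟ q
...   | yes refl = swapℕ-left p m
...   | no m≢q = swapℕ-fix m≢p m≢q

swapℕ-conjugation : ∀ (π : ℕ → ℕ) → (∀ x → π (π x) ≡ x) →
                    ∀ {b c d m} → π c ≡ c → π d ≡ d → m ≢ c → m ≢ d →
                    swapℕ d c (π (swapℕ c b m)) ≡ swapℕ d (π b) (π m)
swapℕ-conjugation π inv {b} {c} {d} {m} πc πd m≢c m≢d with m ℕP.≟ b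
... | yes refl = begin
  swapℕ d c (π (swapℕ c m m)) ≡⟨ cong (swapℕ d c ∘ π) (swapℕ-right c m) ⟩
  swapℕ d c (π c)             ≡⟨ cong (swapℕ d c) πc ⟩
  swapℕ d c c                 ≡⟨ swapℕ-right d c ⟩
  d                           ≡⟨ sym (swapℕ-right d (π m)) ⟩
  swapℕ d (π m) (π m)         ∎
  where open ≡-Reasoning
... | no m≢b = begin
  swapℕ d c (π (swapℕ c b m)) ≡⟨ cong (swapℕ d c ∘ π) (swapℕ-fix m≢c m≢b) ⟩
  swapℕ d c (π m)             ≡⟨ swapℕ-fix πm≢d πm≢c ⟩
  π m                         ≡⟨ sym (swapℕ-fix πm≢d πm≢πb) ⟩
  swapℕ d (π b) (π m)         ∎
  where
  open ≡-Reasoning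
  π-injective : ∀ {x y} → π x ≡ π y → x ≡ y
  π-injective {x} {y} eq = trans (sym (inv x)) (trans (cong π eq) (inv y))
  πm≢c : π m ≢ c
  πm≢c eq = m≢c (π-injective (trans eq (sym πc)))
  πm≢d : π m ≢ d
  πm≢d eq = m≢d (π-injective (trans eq (sym πd)))
  πm≢πb : π m ≢ π b
  πm≢πb eq = m≢b (π-injective eq)

swapIdx-here : ∀ l {k} p q m → k ≡ l → swapIdx l p q k m ≡ swapℕ p q m
swapIdx-here l {k} p q m k≡l with k ℤP.≟ l
... | yes _ = refl
... | no k≢l = contradiction k≡l k≢l

swapIdx-involutive : ∀ l p q k m → swapIdx l p q k (swapIdx l p q k m) ≡ m
swapIdx-involutive l p q k m with k ℤP.≟ l
... | yes _ = swapℕ-involutive p q m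
... | no _ = refl

new≢ : ∀ {x n y k k'} → x < n → n ≤ y → mkAtom k y ≢ mkAtom k' x
new≢ x<n n≤y eq = ℕP.<⇒≢ (ℕP.<-≤-trans x<n n≤y) (sym (cong Atom.idx eq))

_≟A_ : DecidableEquality Atom
mkAtom k m ≟A mkAtom k' m' with k ℤP.≟ k' | m ℕP.≟ m'
... | yes refl | yes refl = yes refl
... | no k≢k'  | _        = no (k≢k' ∘ cong Atom.level)
... | _        | no m≢m'  = no (m≢m' ∘ cong Atom.idx)

swapAtom-involutive : ∀ l p q e → swapAtom l p q (swapAtom l p q e) ≡ e
swapAtom-involutive l p q (mkAtom k m) = cong (mkAtom k) (swapIdx-involutive l p q k m)

swapAtom-right : ∀ l p q → swapAtom l p q (mkAtom l q) ≡ mkAtom l p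
swapAtom-right l p q = cong (mkAtom l) (trans (swapIdx-here l p q q refl) (swapℕ-right p q))

swapAtom-fix : ∀ {l p q} e → e ≢ mkAtom l p → e ≢ mkAtom l q → swapAtom l p q e ≡ e
swapAtom-fix {l} (mkAtom k m) e≢p e≢q with k ℤP.≟ l
... | yes refl = cong (mkAtom k) (swapℕ-fix (e≢p ∘ cong (mkAtom k)) (e≢q ∘ cong (mkAtom k)))
... | no _ = refl

swapAtom-≡ : ∀ {l p q e b} → e ≡ swapAtom l p q b → swapAtom l p q e ≡ b
swapAtom-≡ {l} {p} {q} {b = b} eq = trans (cong (swapAtom l p q) eq) (swapAtom-involutive l p q b)

swapAtom-≢ : ∀ {l p q e b} → e ≢ swapAtom l p q b → swapAtom l p q e ≢ b
swapAtom-≢ {l} {p} {q} {e} ne eq =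
  ne (trans (sym (swapAtom-involutive l p q e)) (cong (swapAtom l p q) eq))

-- Transpositions are the instances used by the theorem,
-- but compositions of them are needed to compare iterated swappings.

Renaming : Set
Renaming = ℤ → ℕ → ℕ

idᵣ : Renaming
idᵣ _ m = m

_∘ᵣ_ : Renaming → Renaming → Renaming
(f ∘ᵣ g) k = f k ∘ g k

renameP : Renaming → Pred → Pred
renameS : Renaming → ∀ {k} → SetT k → SetT k
renameL : Renaming → List Pred → List Pred
renameP f (and xs) = and (renameL f xs)
renameP f (neg X) = neg (renameP f X)
renameP f (all (mkAtom k m) X) = all (mkAtom k (f k m)) (renameP f X)
renameP f (elt {j} y n) = elt (renameS f y) (f (sucℤ j) n)
renameS f {k} (atm m) = atm (f k m)
renameS f {k} (st c X) = st (f (predℤ k) c) (renameP f X)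
renameL f [] = []
renameL f (X ∷ xs) = renameP f X ∷ renameL f xs

swap-as-renameP : ∀ l p q X → swapP l p q X ≡ renameP (swapIdx l p q) X
swap-as-renameS : ∀ l p q {k} (y : SetT k) → swapS l p q y ≡ renameS (swapIdx l p q) y
swap-as-renameL : ∀ l p q xs → swapL l p q xs ≡ renameL (swapIdx l p q) xs
swap-as-renameP l p q (and xs) = cong and (swap-as-renameL l p q xs)
swap-as-renameP l p q (neg X) = cong neg (swap-as-renameP l p q X)
swap-as-renameP l p q (all (mkAtom k m) X) = cong (all _) (swap-as-renameP l p q X)
swap-as-renameP l p q (elt y n) = cong (λ z → elt z _) (swap-as-renameS l p q y)
swap-as-renameS l p q (atm m) = refl
swap-as-renameS l p q (st c X) = cong (st _) (swap-as-renameP l p q X)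
swap-as-renameL l p q [] = refl
swap-as-renameL l p q (X ∷ xs) = cong₂ _∷_ (swap-as-renameP l p q X) (swap-as-renameL l p q xs)

rename-∘P : ∀ f g X → renameP f (renameP g X) ≡ renameP (f ∘ᵣ g) X
rename-∘S : ∀ f g {k} (y : SetT k) → renameS f (renameS g y) ≡ renameS (f ∘ᵣ g) y
rename-∘L : ∀ f g xs → renameL f (renameL g xs) ≡ renameL (f ∘ᵣ g) xs
rename-∘P f g (and xs) = cong and (rename-∘L f g xs)
rename-∘P f g (neg X) = cong neg (rename-∘P f g X)
rename-∘P f g (all (mkAtom k m) X) = cong (all _) (rename-∘P f g X)
rename-∘P f g (elt y n) = cong (λ z → elt z _) (rename-∘S f g y)
rename-∘S f g (atm m) = refl
rename-∘S f g (st c X) = cong (st _) (rename-∘P f g X)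
rename-∘L f g [] = refl
rename-∘L f g (X ∷ xs) = cong₂ _∷_ (rename-∘P f g X) (rename-∘L f g xs)

rename-idP : ∀ X → renameP idᵣ X ≡ X
rename-idS : ∀ {k} (y : SetT k) → renameS idᵣ y ≡ y
rename-idL : ∀ xs → renameL idᵣ xs ≡ xs
rename-idP (and xs) = cong and (rename-idL xs)
rename-idP (neg X) = cong neg (rename-idP X)
rename-idP (all (mkAtom k m) X) = cong (all _) (rename-idP X)
rename-idP (elt y n) = cong (λ z → elt z _) (rename-idS y)
rename-idS (atm m) = refl
rename-idS (st c X) = cong (st _) (rename-idP X)
rename-idL [] = refl
rename-idL (X ∷ xs) = cong₂ _∷_ (rename-idP X) (rename-idL xs)

-- Bounds: BndP N X says that every atom index occurring in X, free or
-- bound, is below N; so atoms with index ≥ N are fresh for X in the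
-- strongest sense.  boundP X is such a bound.

BndP : ℕ → Pred → Set
BndS : ℕ → ∀ {k} → SetT k → Set
BndL : ℕ → List Pred → Set
BndP N (and xs) = BndL N xs
BndP N (neg X) = BndP N X
BndP N (all (mkAtom _ m) X) = m < N × BndP N X
BndP N (elt y m) = BndS N y × m < N
BndS N (atm m) = m < N
BndS N (st m X) = m < N × BndP N X
BndL N [] = ⊤
BndL N (X ∷ xs) = BndP N X × BndL N xs

boundP : Pred → ℕ
boundS : ∀ {k} → SetT k → ℕ
boundL : List Pred → ℕ
boundP (and xs) = boundL xs
boundP (neg X) = boundP X
boundP (all (mkAtom _ m) X) = suc m ⊔ boundP X
boundP (elt y m) = boundS y ⊔ suc m
boundS (atm m) = suc m
boundS (st m X) = suc m ⊔ boundP X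
boundL [] = 0
boundL (X ∷ xs) = boundP X ⊔ boundL xs

boundedP : ∀ X {N} → boundP X ≤ N → BndP N X
boundedS : ∀ {k} (y : SetT k) {N} → boundS y ≤ N → BndS N y
boundedL : ∀ xs {N} → boundL xs ≤ N → BndL N xs
boundedP (and xs) le = boundedL xs le
boundedP (neg X) le = boundedP X le
boundedP (all (mkAtom _ m) X) le =
  ℕP.m⊔n≤o⇒m≤o (suc m) (boundP X) le , boundedP X (ℕP.m⊔n≤o⇒n≤o (suc m) (boundP X) le)
boundedP (elt y m) le =
  boundedS y (ℕP.m⊔n≤o⇒m≤o _ (suc m) le) , ℕP.m⊔n≤o⇒n≤o _ (suc m) le
boundedS (atm m) le = le
boundedS (st m X) le =
  ℕP.m⊔n≤o⇒m≤o (suc m) (boundP X) le , boundedP X (ℕP.m⊔n≤o⇒n≤o (suc m) (boundP X) le)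
boundedL [] le = tt
boundedL (X ∷ xs) le =
  boundedP X (ℕP.m⊔n≤o⇒m≤o _ _ le) , boundedL xs (ℕP.m⊔n≤o⇒n≤o (boundP X) _ le)

freshP : ∀ {N c} l X → BndP N X → N ≤ c → mkAtom l c #P X
freshS : ∀ {N c} l {k} (y : SetT k) → BndS N y → N ≤ c → mkAtom l c #S y
freshL : ∀ {N c} l xs → BndL N xs → N ≤ c → ¬ Any (FreeP (mkAtom l c)) xs
freshP l (and xs) bX N≤c (free-and F) = freshL l xs bX N≤c F
freshP l (neg X) bX N≤c (free-neg F) = freshP l X bX N≤c F
freshP l (all (mkAtom _ _) X) (_ , bX) N≤c (free-all _ F) = freshP l X bX N≤c F
freshP l (elt y m) (by , _) N≤c (free-eltl F) = freshS l y by N≤c F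
freshP l (elt y m) (_ , m<N) N≤c (free-eltr eq) = new≢ m<N N≤c eq
freshS l (atm m) m<N N≤c (free-atm eq) = new≢ m<N N≤c eq
freshS l (st _ X) (_ , bX) N≤c (free-st _ F) = freshP l X bX N≤c F
freshL l (X ∷ xs) (bX , _) N≤c (here F) = freshP l X bX N≤c F
freshL l (X ∷ xs) (_ , bxs) N≤c (there F) = freshL l xs bxs N≤c F

AgreeBelow : ℕ → Renaming → Renaming → Set
AgreeBelow N f g = ∀ k m → m < N → f k m ≡ g k m

rename-cong-belowP : ∀ {N f g} → AgreeBelow N f g → ∀ X → BndP N X → renameP f X ≡ renameP g X
rename-cong-belowS : ∀ {N f g} → AgreeBelow N f g → ∀ {k} (y : SetT k) → BndS N y →
                     renameS f y ≡ renameS g y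
rename-cong-belowL : ∀ {N f g} → AgreeBelow N f g → ∀ xs → BndL N xs → renameL f xs ≡ renameL g xs
rename-cong-belowP ag (and xs) bX = cong and (rename-cong-belowL ag xs bX)
rename-cong-belowP ag (neg X) bX = cong neg (rename-cong-belowP ag X bX)
rename-cong-belowP ag (all (mkAtom k m) X) (m<N , bX) =
  cong₂ (λ u → all (mkAtom k u)) (ag k m m<N) (rename-cong-belowP ag X bX)
rename-cong-belowP ag (elt {j} y n) (by , n<N) =
  cong₂ elt (rename-cong-belowS ag y by) (ag (sucℤ j) n n<N)
rename-cong-belowS ag {k} (atm m) m<N = cong atm (ag k m m<N)
rename-cong-belowS ag {k} (st c X) (c<N , bX) =
  cong₂ st (ag (predℤ k) c c<N) (rename-cong-belowP ag X bX)
rename-cong-belowL ag [] _ = refl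
rename-cong-belowL ag (X ∷ xs) (bX , bxs) =
  cong₂ _∷_ (rename-cong-belowP ag X bX) (rename-cong-belowL ag xs bxs)

-- Size of a term; swapping preserves it, which justifies induction on size
-- through α-renamings.

sizeP : Pred → ℕ
sizeS : ∀ {k} → SetT k → ℕ
sizeL : List Pred → ℕ
sizeP (and xs) = suc (sizeL xs)
sizeP (neg X) = suc (sizeP X)
sizeP (all _ X) = suc (sizeP X)
sizeP (elt y _) = suc (sizeS y)
sizeS (atm _) = 0
sizeS (st _ X) = suc (sizeP X)
sizeL [] = 0
sizeL (X ∷ xs) = sizeP X + sizeL xs

size-swapP : ∀ l p q X → sizeP (swapP l p q X) ≡ sizeP X
size-swapS : ∀ l p q {k} (y : SetT k) → sizeS (swapS l p q y) ≡ sizeS y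
size-swapL : ∀ l p q xs → sizeL (swapL l p q xs) ≡ sizeL xs
size-swapP l p q (and xs) = cong suc (size-swapL l p q xs)
size-swapP l p q (neg X) = cong suc (size-swapP l p q X)
size-swapP l p q (all _ X) = cong suc (size-swapP l p q X)
size-swapP l p q (elt y _) = cong suc (size-swapS l p q y)
size-swapS l p q (atm _) = refl
size-swapS l p q (st _ X) = cong suc (size-swapP l p q X)
size-swapL l p q [] = refl
size-swapL l p q (X ∷ xs) = cong₂ _+_ (size-swapP l p q X) (size-swapL l p q xs)

swap-smaller : ∀ {n} l p q X → sizeP X < n → sizeP (swapP l p q X) < n
swap-smaller {n} l p q X = subst (_< n) (sym (size-swapP l p q X))

head-smaller : ∀ {n} X xs → sizeL (X ∷ xs) < n → sizeP X < n
head-smaller X xs = ℕP.≤-<-trans (ℕP.m≤m+n (sizeP X) (sizeL xs))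

tail-smaller : ∀ {n} X xs → sizeL (X ∷ xs) < n → sizeL xs < n
tail-smaller X xs = ℕP.≤-<-trans (ℕP.m≤n+m (sizeL xs) (sizeP X))

free-swapP : ∀ {l p q e} X → FreeP e (swapP l p q X) → FreeP (swapAtom l p q e) X
free-swapS : ∀ {l p q e k} (y : SetT k) → FreeS e (swapS l p q y) → FreeS (swapAtom l p q e) y
free-swapL : ∀ {l p q e} xs → Any (FreeP e) (swapL l p q xs) → Any (FreeP (swapAtom l p q e)) xs
free-swapP (and xs) (free-and F) = free-and (free-swapL xs F)
free-swapP (neg X) (free-neg F) = free-neg (free-swapP X F)
free-swapP (all (mkAtom _ _) X) (free-all ne F) = free-all (swapAtom-≢ ne) (free-swapP X F)
free-swapP (elt y _) (free-eltl F) = free-eltl (free-swapS y F)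
free-swapP (elt y _) (free-eltr eq) = free-eltr (swapAtom-≡ eq)
free-swapS (atm _) (free-atm eq) = free-atm (swapAtom-≡ eq)
free-swapS (st _ X) (free-st ne F) = free-st (swapAtom-≢ ne) (free-swapP X F)
free-swapL (X ∷ xs) (here F) = here (free-swapP X F)
free-swapL (X ∷ xs) (there F) = there (free-swapL xs F)

fresh-swap : ∀ {l p q e X} → e #P X → e ≢ mkAtom l p → e ≢ mkAtom l q → e #P swapP l p q X
fresh-swap {X = X} e#X e≢p e≢q F =
  e#X (subst (λ e' → FreeP e' X) (swapAtom-fix _ e≢p e≢q) (free-swapP X F))

≈-reflP : ∀ n X → sizeP X < n → X ≈P X
≈-reflS : ∀ n {k} (y : SetT k) → sizeS y < n → y ≈S y
≈-reflL : ∀ n xs → sizeL xs < n → All (λ X → X ≈P X) xs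
≈-reflP (suc n) (and xs) (s≤s h) =
  ≈and (All.tabulate λ x∈ → lose x∈ (All.lookup refls x∈))
       (All.tabulate λ x∈ → lose x∈ (All.lookup refls x∈))
  where refls = ≈-reflL n xs h
≈-reflP (suc n) (neg X) (s≤s h) = ≈neg (≈-reflP n X h)
≈-reflP (suc n) (all (mkAtom l p) X) (s≤s h) =
  ≈all c c#X c#X (≈-reflP n (swapP l c p X) (swap-smaller l c p X h))
  where
  c = boundP X
  c#X = freshP l X (boundedP X ℕP.≤-refl) ℕP.≤-refl
≈-reflP (suc n) (elt y m) (s≤s h) = ≈elt (≈-reflS n y h)
≈-reflS (suc n) (atm m) _ = ≈atm
≈-reflS (suc n) {k} (st p X) (s≤s h) =
  ≈st c c#X c#X (≈-reflP n (swapP (predℤ k) c p X) (swap-smaller (predℤ k) c p X h))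
  where
  c = boundP X
  c#X = freshP (predℤ k) X (boundedP X ℕP.≤-refl) ℕP.≤-refl
≈-reflL n [] _ = []
≈-reflL n (X ∷ xs) h = ≈-reflP n X (head-smaller X xs h) ∷ ≈-reflL n xs (tail-smaller X xs h)

≈-reflexive : ∀ {X Y} → X ≡ Y → X ≈P Y
≈-reflexive {X} refl = ≈-reflP (suc (sizeP X)) X ℕP.≤-refl

Involution : Renaming → Set
Involution π = ∀ k m → π k (π k m) ≡ m

swap-conjugation : ∀ π → Involution π → ∀ l b c d {N} Y → BndP N Y → N ≤ c → N ≤ d →
                   π l c ≡ c → π l d ≡ d →
                   swapP l d c (renameP π (swapP l c b Y)) ≡ swapP l d (π l b) (renameP π Y)
swap-conjugation π inv l b c d {N} Y bY N≤c N≤d πc πd = begin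
  swapP l d c (renameP π (swapP l c b Y))
    ≡⟨ swap-as-renameP l d c _ ⟩
  renameP σdc (renameP π (swapP l c b Y))
    ≡⟨ cong (renameP σdc ∘ renameP π) (swap-as-renameP l c b Y) ⟩
  renameP σdc (renameP π (renameP σcb Y))
    ≡⟨ cong (renameP σdc) (rename-∘P π σcb Y) ⟩
  renameP σdc (renameP (π ∘ᵣ σcb) Y)
    ≡⟨ rename-∘P σdc (π ∘ᵣ σcb) Y ⟩
  renameP (σdc ∘ᵣ (π ∘ᵣ σcb)) Y
    ≡⟨ rename-cong-belowP agree Y bY ⟩
  renameP (σdπb ∘ᵣ π) Y
    ≡⟨ sym (rename-∘P σdπb π Y) ⟩
  renameP σdπb (renameP π Y)
    ≡⟨ sym (swap-as-renameP l d (π l b) _) ⟩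
  swapP l d (π l b) (renameP π Y) ∎
  where
  open ≡-Reasoning
  σdc σcb σdπb : Renaming
  σdc = swapIdx l d c
  σcb = swapIdx l c b
  σdπb = swapIdx l d (π l b)
  agree : AgreeBelow N (σdc ∘ᵣ (π ∘ᵣ σcb)) (σdπb ∘ᵣ π)
  agree k m m<N with k ℤP.≟ l
  ... | yes refl = swapℕ-conjugation (π k) (inv k) πc πd (ℕP.<⇒≢ (ℕP.<-≤-trans m<N N≤c))
                                                        (ℕP.<⇒≢ (ℕP.<-≤-trans m<N N≤d))
  ... | no _ = refl

swap-rebind : ∀ l b c d {N} Y → BndP N Y → N ≤ c → N ≤ d →
              swapP l d c (swapP l c b Y) ≡ swapP l d b Y
swap-rebind l b c d Y bY N≤c N≤d = begin
  swapP l d c (swapP l c b Y)              ≡⟨ cong (swapP l d c) (sym (rename-idP _)) ⟩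
  swapP l d c (renameP idᵣ (swapP l c b Y))
    ≡⟨ swap-conjugation idᵣ (λ _ _ → refl) l b c d Y bY N≤c N≤d refl refl ⟩
  swapP l d b (renameP idᵣ Y)              ≡⟨ cong (swapP l d b) (rename-idP Y) ⟩
  swapP l d b Y                            ∎
  where open ≡-Reasoning

swap-conjugate-swap : ∀ i p q l b c d {N} Y → BndP N Y → N ≤ c → N ≤ d →
                      mkAtom l c ≢ mkAtom i p → mkAtom l c ≢ mkAtom i q →
                      mkAtom l d ≢ mkAtom i p → mkAtom l d ≢ mkAtom i q →
                      swapP l d c (swapP i p q (swapP l c b Y))
                        ≡ swapP l d (swapIdx i p q l b) (swapP i p q Y)
swap-conjugate-swap i p q l b c d Y bY N≤c N≤d c≢p c≢q d≢p d≢q = begin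
  swapP l d c (swapP i p q (swapP l c b Y))
    ≡⟨ cong (swapP l d c) (swap-as-renameP i p q _) ⟩
  swapP l d c (renameP π (swapP l c b Y))
    ≡⟨ swap-conjugation π (swapIdx-involutive i p q) l b c d Y bY N≤c N≤d
         (cong Atom.idx (swapAtom-fix _ c≢p c≢q)) (cong Atom.idx (swapAtom-fix _ d≢p d≢q)) ⟩
  swapP l d (π l b) (renameP π Y)
    ≡⟨ cong (swapP l d (π l b)) (sym (swap-as-renameP i p q Y)) ⟩
  swapP l d (π l b) (swapP i p q Y) ∎
  where
  open ≡-Reasoning
  π : Renaming
  π = swapIdx i p q

module FreshSubstitution (i : ℤ) (a a' : ℕ) where

  ClaimP : Pred → Set
  ClaimP Z = mkAtom i a' #P Z → SubP i a a' Z (swapP i a' a Z)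

  ClaimS : ∀ {k} → SetT k → Set
  ClaimS z = mkAtom i a' #S z → SubS i a a' z (swapS i a' a z)

  swapped-a : ∀ {k m} → mkAtom k m ≡ mkAtom i a → swapIdx i a' a k m ≡ a'
  swapped-a eq = cong Atom.idx (trans (cong (swapAtom i a' a) eq) (swapAtom-right i a' a))

  swapped-other : ∀ {k m} → mkAtom k m ≢ mkAtom i a → mkAtom k m ≢ mkAtom i a' →
                  swapIdx i a' a k m ≡ m
  swapped-other ne ne' = cong Atom.idx (swapAtom-fix _ ne' ne)

  atm-case : ∀ {k} m → ClaimS (atm {k} m)
  atm-case {k} m a'#z with mkAtom k m ≟A mkAtom i a
  ... | yes e≡a = subst₂ (λ m n → SubS i a a' (atm m) (atm n))
                         (sym (cong Atom.idx e≡a)) (sym (swapped-a e≡a))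
                         (sub-atma (cong Atom.level e≡a))
  ... | no e≢a = subst (λ n → SubS i a a' (atm m) (atm n))
                       (sym (swapped-other e≢a λ eq → a'#z (free-atm (sym eq))))
                       (sub-atmb e≢a)

  elt-case : ∀ {j} (y : SetT j) m → SubS i a a' y (swapS i a' a y) → ClaimP (elt y m)
  elt-case {j} y m sub-y a'#Z with mkAtom (sucℤ j) m ≟A mkAtom i a
  ... | yes e≡a = subst₂ (λ m n → SubP i a a' (elt y m) (elt (swapS i a' a y) n))
                         (sym (cong Atom.idx e≡a)) (sym (swapped-a e≡a))
                         (sub-elta (cong Atom.level e≡a) sub-y)
  ... | no e≢a = subst (λ n → SubP i a a' (elt y m) (elt (swapS i a' a y) n))
                       (sym (swapped-other e≢a λ eq → a'#Z (free-eltr (sym eq))))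
                       (sub-eltb e≢a sub-y)

  record AlphaStep (l : ℤ) (b : ℕ) (Y : Pred) : Set where
    field
      c d        : ℕ
      c≢a        : mkAtom l c ≢ mkAtom i a
      c≢a'       : mkAtom l c ≢ mkAtom i a'
      d#Y        : mkAtom l d #P Y
      d#cbY      : mkAtom l d #P swapP l c b Y
      d#π-cbY    : mkAtom l d #P swapP i a' a (swapP l c b Y)
      d#πY       : mkAtom l d #P swapP i a' a Y
      rename-in  : swapP l d b Y ≈P swapP l d c (swapP l c b Y)
      substitute : SubP i a a' (swapP l c b Y) (swapP i a' a (swapP l c b Y))
      rename-out : swapP l d c (swapP i a' a (swapP l c b Y))
                     ≈P swapP l d (swapIdx i a' a l b) (swapP i a' a Y)

  -- Such a step exists as soon as the claim holds for all swapped copies of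
  -- the body and a' can be free in Y only as the bound atom itself.
  -- Take c, d beyond every index in Y, a, a' and b.

  alpha-step : ∀ l b Y → (∀ p q → ClaimP (swapP l p q Y)) →
               (mkAtom i a' ≢ mkAtom l b → mkAtom i a' #P Y) → AlphaStep l b Y
  alpha-step l b Y claim a'#Y = record
    { c = N ; d = suc N ; c≢a = c≢a ; c≢a' = c≢a'
    ; d#Y = d#Y ; d#cbY = d#cbY
    ; d#π-cbY = fresh-swap d#cbY d≢a' d≢a
    ; d#πY = fresh-swap d#Y d≢a' d≢a
    ; rename-in = ≈-reflexive (sym (swap-rebind l b N (suc N) Y bY ℕP.≤-refl N≤d))
    ; substitute = claim N b a'#cbY
    ; rename-out = ≈-reflexive (swap-conjugate-swap i a' a l b N (suc N) Y bY ℕP.≤-refl N≤d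
                                                    c≢a' c≢a d≢a' d≢a)
    }
    where
    N = boundP Y ⊔ suc a ⊔ suc a' ⊔ suc b
    bY : BndP N Y
    bY = boundedP Y (ℕP.≤-trans (ℕP.m≤m⊔n _ (suc a))
                                (ℕP.≤-trans (ℕP.m≤m⊔n _ (suc a')) (ℕP.m≤m⊔n _ (suc b))))
    a<N : a < N
    a<N = ℕP.≤-trans (ℕP.m≤n⊔m (boundP Y) (suc a))
                     (ℕP.≤-trans (ℕP.m≤m⊔n _ (suc a')) (ℕP.m≤m⊔n _ (suc b)))
    a'<N : a' < N
    a'<N = ℕP.≤-trans (ℕP.m≤n⊔m _ (suc a')) (ℕP.m≤m⊔n _ (suc b))
    b<N : b < N
    b<N = ℕP.m≤n⊔m _ (suc b)
    N≤d : N ≤ suc N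
    N≤d = ℕP.n≤1+n N
    c≢a : mkAtom l N ≢ mkAtom i a
    c≢a = new≢ a<N ℕP.≤-refl
    c≢a' : mkAtom l N ≢ mkAtom i a'
    c≢a' = new≢ a'<N ℕP.≤-refl
    d≢a : mkAtom l (suc N) ≢ mkAtom i a
    d≢a = new≢ a<N N≤d
    d≢a' : mkAtom l (suc N) ≢ mkAtom i a'
    d≢a' = new≢ a'<N N≤d
    d#Y : mkAtom l (suc N) #P Y
    d#Y = freshP l Y bY N≤d
    d#cbY : mkAtom l (suc N) #P swapP l N b Y
    d#cbY = fresh-swap d#Y (new≢ (ℕP.n<1+n N) ℕP.≤-refl) (new≢ b<N N≤d)
    -- a' is fresh for (c b)·Y: if a' = b it became c, otherwise it is untouched.
    a'#cbY : mkAtom i a' #P swapP l N b Y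
    a'#cbY F with mkAtom i a' ≟A mkAtom l b
    ... | yes a'≡b = freshP l Y bY ℕP.≤-refl (subst (λ e → FreeP e Y) moved (free-swapP Y F))
      where moved = trans (cong (swapAtom l N b) a'≡b) (swapAtom-right l N b)
    ... | no a'≢b = a'#Y a'≢b (subst (λ e → FreeP e Y) kept (free-swapP Y F))
      where kept = swapAtom-fix _ (c≢a' ∘ sym) a'≢b

  all-case : ∀ l b Y → AlphaStep l b Y →
             SubP i a a' (all (mkAtom l b) Y) (swapP i a' a (all (mkAtom l b) Y))
  all-case l b Y step =
    sub-≈ (≈all d d#Y d#cbY rename-in)
          (sub-all c≢a (λ { (free-atm eq) → c≢a' eq }) substitute)
          (≈all d d#π-cbY d#πY rename-out)
    where open AlphaStep step

  st-case : ∀ k b Y → AlphaStep (predℤ k) b Y →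
            SubS i a a' (st {k} b Y) (swapS i a' a (st {k} b Y))
  st-case k b Y step =
    sub-≈ (≈st d d#Y d#cbY rename-in)
          (sub-st c≢a (λ { (free-atm eq) → c≢a' eq }) substitute)
          (≈st d d#π-cbY d#πY rename-out)
    where open AlphaStep step

  claimP : ∀ n Z → sizeP Z < n → ClaimP Z
  claimS : ∀ n {k} (z : SetT k) → sizeS z < n → ClaimS z
  claimL : ∀ n xs → sizeL xs < n → mkAtom i a' #P and xs →
           Pointwise (SubP i a a') xs (swapL i a' a xs)
  claimP (suc n) (and xs) (s≤s h) a'#Z = sub-and (claimL n xs h a'#Z)
  claimP (suc n) (neg X) (s≤s h) a'#Z = sub-neg (claimP n X h (a'#Z ∘ free-neg))
  claimP (suc n) (all (mkAtom l b) Y) (s≤s h) a'#Z =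
    all-case l b Y (alpha-step l b Y
                      (λ p q → claimP n (swapP l p q Y) (swap-smaller l p q Y h))
                      (λ ne F → a'#Z (free-all ne F)))
  claimP (suc n) (elt y m) (s≤s h) a'#Z = elt-case y m (claimS n y h (a'#Z ∘ free-eltl)) a'#Z
  claimS (suc n) (atm m) _ = atm-case m
  claimS (suc n) {k} (st b Y) (s≤s h) a'#z =
    st-case k b Y (alpha-step (predℤ k) b Y
                     (λ p q → claimP n (swapP (predℤ k) p q Y) (swap-smaller (predℤ k) p q Y h))
                     (λ ne F → a'#z (free-st ne F)))
  claimL n [] _ _ = []
  claimL n (X ∷ xs) h a'#Z =
    claimP n X (head-smaller X xs h) (a'#Z ∘ free-and ∘ here)
      ∷ claimL n xs (tail-smaller X xs h) (λ { (free-and F) → a'#Z (free-and (there F)) })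

lemma4p18 : (i : ℤ) (a a' : ℕ) → a ≢ a' →
            ((Z : Pred) → mkAtom i a' #P Z → SubP i a a' Z (swapP i a' a Z))
            × ((k : ℤ) (z : SetT k) → mkAtom i a' #S z → SubS i a a' z (swapS i a' a z))
lemma4p18 i a a' _ =
    (λ Z → claimP (suc (sizeP Z)) Z ℕP.≤-refl)
  , (λ k z → claimS (suc (sizeS z)) z ℕP.≤-refl)
  where open FreshSubstitution i a a'
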